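{- Let $K$ be a $(d-1)$-dimensional cubical complex and $n\ge 0$. Then \[ h^{(sc)}_{\mathrm{sd}_c^n(K)}(x) = \left(\frac{(2^n-1)x+2^n+1}{2}\right)^{d-1} h^{(sc)}_K\!\left(\frac{(2^n+1)x+2^n-1}{(2^n-1)x+2^n+1}\right). \]
   Context: A cubical complex is a finite collection $K$ of polytopes in $\mathbb{R}^n$, each combinatorially isomorphic to a cube $[0,1]^m$, closed under taking faces and such that any two intersect in a common face; $f_j(K)$ is its number of $j$-dimensional faces. For a $(d-1)$-dimensional cubical complex $K$, the short cubical $h$-polynomial is $h^{(sc)}_K(x) = \sum_{j=0}^{d-1} f_j(K)(2x)^j(1-x)^{d-1-j}$. The cubical barycentric subdivision $\mathrm{sd}_c(K)$ is the cubical complex whose vertices are the barycenters of the nonempty faces of $K$ and whose nonempty faces are, for each closed interval $[F,G]$ in the poset of nonempty faces of $K$ ordered by inclusion, the convex hull of the barycenters of the faces in $[F,G]$; it has the same dimension as $K$. Iterates: $\mathrm{sd}_c^0(K)=K$ and $\mathrm{sd}_c^n(K)=\mathrm{sd}_c(\mathrm{sd}_c^{n-1}(K))$ for $n\ge1$. -}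

module Defs where

open import Data.Nat as ℕ using (ℕ; zero; suc; _∸_; _≟_)
open import Data.Integer using (+_)
open import Data.Rational as ℚ using (ℚ; _/_; 0ℚ; 1ℚ; NonZero)
open import Data.List using (List; filter; cartesianProduct; length; map; foldr; upTo)
open import Data.List.Membership.Propositional using (_∈_)
open import Data.List.Relation.Unary.Unique.Propositional using (Unique)
open import Data.Vec using (Vec)
open import Data.Vec.Relation.Binary.Pointwise.Inductive using (Pointwise)
open import Data.Product using (Σ; ∃; _×_; _,_; proj₁; proj₂)
open import Relation.Nullary.Decidable using () renaming (_×-dec_ to _×?_)
open import Data.Sum using (_⊎_)
open import Data.Empty using (⊥)
open import Function using (_∘_)
open import Relation.Nullary using (¬_; Dec)
open import Relation.Binary using (Rel; Decidable; IsPartialOrder)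
open import Relation.Binary.PropositionalEquality using (_≡_)

-- Face posets (the combinatorial data of a polyhedral complex):
-- a carrier type, a duplicate-free list of the (nonempty) faces,
-- the inclusion order between faces, and the dimension of each face.

record FacePoset : Set₁ where
  field
    Face  : Set
    faces : List Face
    _≤_   : Rel Face _
    _≤?_  : Decidable _≤_
    dim   : Face → ℕ

-- The face poset of the m-cube [0,1]^m: nonempty faces are words in
-- {0,1,*}^m; u ≤ v iff for every i, v_i = * or u_i = v_i;
-- the dimension of a face is its number of *'s.

data CubeCoord : Set where
  c0 c1 star : CubeCoord

_≤coord_ : CubeCoord → CubeCoord → Set
u ≤coord v = (v ≡ star) ⊎ (u ≡ v)

_≤cube_ : ∀ {m} → Vec CubeCoord m → Vec CubeCoord m → Set
_≤cube_ = Pointwise _≤coord_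

starCount : ∀ {m} → Vec CubeCoord m → ℕ
starCount Vec.[] = 0
starCount (star Vec.∷ v) = suc (starCount v)
starCount (c0 Vec.∷ v) = starCount v
starCount (c1 Vec.∷ v) = starCount v

module _ (P : FacePoset) where
  open FacePoset P

  -- the closed interval below G (faces of G) is isomorphic, as a graded
  -- poset, to the face poset of the (dim G)-cube
  record CubeIso (G : Face) : Set where
    field
      φ : Face → Vec CubeCoord (dim G)
      ψ : Vec CubeCoord (dim G) → Face
      ψ-face  : ∀ v → ψ v ∈ faces
      ψ-below : ∀ v → ψ v ≤ G
      φψ : ∀ v → φ (ψ v) ≡ v
      ψφ : ∀ F → F ∈ faces → F ≤ G → ψ (φ F) ≡ F
      mono : ∀ F F′ → F ∈ faces → F ≤ G → F′ ∈ faces → F′ ≤ G →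
             F ≤ F′ → φ F ≤cube φ F′
      reflect : ∀ F F′ → F ∈ faces → F ≤ G → F′ ∈ faces → F′ ≤ G →
                φ F ≤cube φ F′ → F ≤ F′
      dim-φ : ∀ F → F ∈ faces → F ≤ G → dim F ≡ starCount (φ F)

  CommonFace : Face → Face → Face → Set
  CommonFace F G H = H ∈ faces × H ≤ F × H ≤ G

  record IsCubicalComplex : Set where
    field
      unique       : Unique faces
      partialOrder : IsPartialOrder _≡_ _≤_
      -- closed under taking faces, each face a combinatorial cube
      cube         : ∀ G → G ∈ faces → CubeIso G
      -- any two faces intersect in a common face (possibly empty)
      intersection : ∀ F G → F ∈ faces → G ∈ faces →
                     (∀ H → ¬ CommonFace F G H) ⊎
                     (Σ Face λ M → CommonFace F G M ×
                        (∀ H → CommonFace F G H → H ≤ M))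

  HasDimension : ℕ → Set
  HasDimension k = (∀ F → F ∈ faces → dim F ℕ.≤ k) ×
                   (Σ Face λ F → F ∈ faces × dim F ≡ k)

  fVec : ℕ → ℕ
  fVec j = length (filter (λ F → dim F ≟ j) faces)

-- Cubical barycentric subdivision: faces are closed intervals [F,G]
-- (F ≤ G) of the face poset; [F,G] ⊆ [F′,G′] iff F′ ≤ F and G ≤ G′;
-- the face conv{barycenters of [F,G]} has dimension dim G − dim F.

sdc : FacePoset → FacePoset
sdc P = record
  { Face  = Face × Face
  ; faces = filter (λ p → proj₁ p ≤? proj₂ p) (cartesianProduct faces faces)
  ; _≤_   = λ p q → (proj₁ q ≤ proj₁ p) × (proj₂ p ≤ proj₂ q)
  ; _≤?_  = λ p q → (proj₁ q ≤? proj₁ p) ×? (proj₂ p ≤? proj₂ q)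
  ; dim   = λ p → dim (proj₂ p) ∸ dim (proj₁ p)
  }
  where open FacePoset P

sdc^ : ℕ → FacePoset → FacePoset
sdc^ zero    P = P
sdc^ (suc n) P = sdc (sdc^ n P)

infixr 8 _^ℚ_
_^ℚ_ : ℚ → ℕ → ℚ
x ^ℚ zero  = 1ℚ
x ^ℚ suc n = x ℚ.* (x ^ℚ n)

ℕ→ℚ : ℕ → ℚ
ℕ→ℚ n = + n / 1

sumTo : ℕ → (ℕ → ℚ) → ℚ
sumTo k g = foldr ℚ._+_ 0ℚ (map g (upTo (suc k)))

-- short cubical h-polynomial of a (k)-dimensional complex (k = d-1),
-- evaluated at x:  Σ_{j=0}^{k} f_j (2x)^j (1-x)^{k-j}
hsc : ℕ → FacePoset → ℚ → ℚ
hsc k P x = sumTo k (λ j → ℕ→ℚ (fVec P j) ℚ.* ((ℕ→ℚ 2 ℚ.* x) ^ℚ j)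
                              ℚ.* ((1ℚ ℚ.- x) ^ℚ (k ∸ j)))

denomB : ℕ → ℚ → ℚ
denomB n x = (ℕ→ℚ (2 ℕ.^ n) ℚ.- 1ℚ) ℚ.* x ℚ.+ ℕ→ℚ (2 ℕ.^ n) ℚ.+ 1ℚ

numerA : ℕ → ℚ → ℚ
numerA n x = (ℕ→ℚ (2 ℕ.^ n) ℚ.+ 1ℚ) ℚ.* x ℚ.+ ℕ→ℚ (2 ℕ.^ n) ℚ.- 1ℚ

module Submission where

-- For a face poset P and k ≥ all face dimensions put
--   E_P(a,b) = Σ_F a^{dim F} b^{k - dim F}          (faceSum),
-- the face generating function homogenised in degree k.  Grouping faces
-- by dimension gives h^{sc}_P(x) = E_P(2x, 1 - x), and E_P is homogeneous
-- of degree k.  The heart of the proof is the one-step identity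
--   E_{sd_c P}(a,b) = E_P(2a + b, b),
-- valid for every "cubical poset": a face poset whose lower intervals have
-- the face numbers of a cube, Σ_{F ≤ G} a^{dim G - dim F} b^{dim F} = (2a+b)^{dim G},
-- and whose closed intervals are boolean, Σ_{F ≤ H ≤ G} u^{dim H - dim F}
-- v^{dim G - dim H} = (u+v)^{dim G - dim F}.  A cubical complex is a cubical
-- poset (its charts reduce both sums to computations on words in {0,1,*}^m),
-- and sd_c preserves cubical posets since the intervals of sd_c P are products
-- of intervals of P.  Iterating, E_{sd_c^n P}(a,b) = E_P(2^n a + (2^n - 1) b, b);
-- substituting a = 2x, b = 1 - x and rescaling by homogeneity gives the claim.

open import Defs
open import Data.Nat using (ℕ)
open import Data.Rational using (ℚ; _*_; _÷_; NonZero)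
open import Relation.Binary.PropositionalEquality using (_≡_)

open import Data.Nat as ℕ using (zero; suc; _∸_; _≟_)
import Data.Nat.Properties as ℕP
open import Data.Nat.Tactic.RingSolver using (solve-∀)
import Data.Integer as ℤ
import Data.Integer.Properties as ℤP
open import Data.Rational using (0ℚ; 1ℚ; _+_; _-_; 1/_)
import Data.Rational.Properties as ℚP
import Data.Rational.Unnormalised as ℚᵘ
import Data.Rational.Unnormalised.Properties as ℚᵘP
open import Data.Rational.Solver using (module +-*-Solver)
open import Data.List using (List; []; _∷_; _++_; map; foldr; filter; length; upTo; cartesianProduct)
open import Data.List.Membership.Propositional using (_∈_)
open import Data.List.Membership.Propositional.Properties using (∈-filter⁻; ∈-cartesianProduct⁻; ∈-upTo⁺)
open import Data.List.Relation.Unary.Any using (here; there)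
import Data.List.Relation.Unary.All as All
open import Data.List.Relation.Unary.AllPairs using ([]; _∷_)
open import Data.List.Relation.Unary.Unique.Propositional using (Unique)
open import Data.List.Relation.Unary.Unique.Propositional.Properties using (upTo⁺)
open import Data.Vec using (Vec; []; _∷_)
import Data.Vec.Properties as VecP
open import Data.Vec.Relation.Binary.Pointwise.Inductive as Pointwise using ([]; _∷_)
open import Data.Product using (_×_; _,_; proj₁; proj₂)
open import Data.Sum using (inj₁; inj₂)
open import Data.Empty using (⊥-elim)
open import Function using (id)
open import Relation.Nullary using (¬_; Dec; yes; no)
open import Relation.Nullary.Decidable using (_×-dec_; _⊎-dec_)
open import Relation.Binary using (DecidableEquality; IsPartialOrder)
open import Relation.Binary.PropositionalEquality
  using (refl; sym; trans; cong; cong₂; subst; module ≡-Reasoning)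

open ≡-Reasoning
open +-*-Solver

private
  variable
    A B C : Set

sumOver : List A → (A → ℚ) → ℚ
sumOver xs t = foldr _+_ 0ℚ (map t xs)

sumOver-cong : (xs : List A) {t t′ : A → ℚ} →
               (∀ x → x ∈ xs → t x ≡ t′ x) → sumOver xs t ≡ sumOver xs t′
sumOver-cong []       _ = refl
sumOver-cong (x ∷ xs) h = cong₂ _+_ (h x (here refl)) (sumOver-cong xs (λ y y∈ → h y (there y∈)))

sumOver-vanish : (xs : List A) {t : A → ℚ} → (∀ x → x ∈ xs → t x ≡ 0ℚ) → sumOver xs t ≡ 0ℚ
sumOver-vanish []       _ = refl
sumOver-vanish (x ∷ xs) h = cong₂ _+_ (h x (here refl)) (sumOver-vanish xs (λ y y∈ → h y (there y∈)))

sumOver-+ : (xs : List A) (t u : A → ℚ) →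
            sumOver xs (λ x → t x + u x) ≡ sumOver xs t + sumOver xs u
sumOver-+ []       t u = refl
sumOver-+ (x ∷ xs) t u =
  trans (cong (t x + u x +_) (sumOver-+ xs t u))
        (solve 4 (λ a b c d → (a :+ b) :+ (c :+ d) := (a :+ c) :+ (b :+ d)) refl
               (t x) (u x) (sumOver xs t) (sumOver xs u))

sumOver-*ˡ : (xs : List A) (c : ℚ) (t : A → ℚ) → c * sumOver xs t ≡ sumOver xs (λ x → c * t x)
sumOver-*ˡ []       c t = ℚP.*-zeroʳ c
sumOver-*ˡ (x ∷ xs) c t = trans (ℚP.*-distribˡ-+ c (t x) _) (cong (c * t x +_) (sumOver-*ˡ xs c t))

sumOver-*ʳ : (xs : List A) (c : ℚ) (t : A → ℚ) → sumOver xs t * c ≡ sumOver xs (λ x → t x * c)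
sumOver-*ʳ xs c t = trans (ℚP.*-comm _ c)
  (trans (sumOver-*ˡ xs c t) (sumOver-cong xs (λ x _ → ℚP.*-comm c (t x))))

sumOver-++ : (xs ys : List A) (t : A → ℚ) → sumOver (xs ++ ys) t ≡ sumOver xs t + sumOver ys t
sumOver-++ []       ys t = sym (ℚP.+-identityˡ _)
sumOver-++ (x ∷ xs) ys t = trans (cong (t x +_) (sumOver-++ xs ys t)) (sym (ℚP.+-assoc (t x) _ _))

sumOver-map : (f : A → B) (xs : List A) (t : B → ℚ) → sumOver (map f xs) t ≡ sumOver xs (λ x → t (f x))
sumOver-map f []       t = refl
sumOver-map f (x ∷ xs) t = cong (t (f x) +_) (sumOver-map f xs t)

sumOver-cartesianProduct : (xs : List A) (ys : List B) (t : A × B → ℚ) →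
  sumOver (cartesianProduct xs ys) t ≡ sumOver xs (λ x → sumOver ys (λ y → t (x , y)))
sumOver-cartesianProduct []       ys t = refl
sumOver-cartesianProduct (x ∷ xs) ys t =
  trans (sumOver-++ (map (x ,_) ys) _ t)
        (cong₂ _+_ (sumOver-map (x ,_) ys t) (sumOver-cartesianProduct xs ys t))

sumOver-swap : (xs : List A) (ys : List B) (t : A → B → ℚ) →
  sumOver xs (λ x → sumOver ys (t x)) ≡ sumOver ys (λ y → sumOver xs (λ x → t x y))
sumOver-swap []       ys t = sym (sumOver-vanish ys (λ _ _ → refl))
sumOver-swap (x ∷ xs) ys t = trans (cong (sumOver ys (t x) +_) (sumOver-swap xs ys t)) (sym (sumOver-+ ys (t x) _))

sumOver-concentrated : (xs : List A) (t : A → ℚ) (c : A) → Unique xs → c ∈ xs →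
  (∀ x → x ∈ xs → ¬ x ≡ c → t x ≡ 0ℚ) → sumOver xs t ≡ t c
sumOver-concentrated (x ∷ xs) t c (x∉ ∷ _) (here refl) h =
  trans (cong (t x +_) (sumOver-vanish xs (λ y y∈ → h y (there y∈) (λ y≡x → All.lookup x∉ y∈ (sym y≡x)))))
        (ℚP.+-identityʳ _)
sumOver-concentrated (x ∷ xs) t c (x∉ ∷ xs-unique) (there c∈) h =
  trans (cong₂ _+_ (h x (here refl) (All.lookup x∉ c∈))
                   (sumOver-concentrated xs t c xs-unique c∈ (λ y y∈ → h y (there y∈))))
        (ℚP.+-identityˡ _)

iverson : Dec A → ℚ → ℚ
iverson (yes _) q = q
iverson (no _)  _ = 0ℚ

iverson-yes : A → (d : Dec A) (q : ℚ) → iverson d q ≡ q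
iverson-yes a (yes _) q = refl
iverson-yes a (no ¬a) q = ⊥-elim (¬a a)

iverson-no : ¬ A → (d : Dec A) (q : ℚ) → iverson d q ≡ 0ℚ
iverson-no ¬a (yes a) q = ⊥-elim (¬a a)
iverson-no ¬a (no _)  q = refl

iverson-cong : {p q : ℚ} → (A → B) → (B → A) → (B → p ≡ q) →
               (d : Dec A) (e : Dec B) → iverson d p ≡ iverson e q
iverson-cong to from p≡q (yes a) e = trans (p≡q (to a)) (sym (iverson-yes (to a) e _))
iverson-cong to from p≡q (no ¬a) e = sym (iverson-no (λ b → ¬a (from b)) e _)

iverson-*ˡ : (d : Dec A) (p q : ℚ) → iverson d (p * q) ≡ p * iverson d q
iverson-*ˡ (yes _) p q = refl
iverson-*ˡ (no _)  p q = sym (ℚP.*-zeroʳ p)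

iverson-unit : (d : Dec A) (q : ℚ) → iverson d 1ℚ * q ≡ iverson d q
iverson-unit (yes _) q = ℚP.*-identityˡ q
iverson-unit (no _)  q = ℚP.*-zeroˡ q

iverson-*-when : {S′ : ℚ} (d : Dec A) (p S : ℚ) → (A → S ≡ S′) → iverson d p * S ≡ iverson d (p * S′)
iverson-*-when (yes a) p S S≡S′ = cong (p *_) (S≡S′ a)
iverson-*-when (no _)  p S _    = ℚP.*-zeroˡ S

iverson-nested : (d : Dec A) (e : Dec B) (q : ℚ) → iverson d (iverson e q) ≡ iverson (d ×-dec e) q
iverson-nested (yes _) (yes _) q = refl
iverson-nested (yes _) (no _)  q = refl
iverson-nested (no _)  e       q = refl

iverson-product : (d : Dec A) (e : Dec B) (p q : ℚ) →
                  iverson d p * iverson e q ≡ iverson (d ×-dec e) (p * q)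
iverson-product (yes _) (yes _) p q = refl
iverson-product (yes _) (no _)  p q = ℚP.*-zeroʳ p
iverson-product (no _)  e       p q = ℚP.*-zeroˡ (iverson e q)

iverson-factor : {p q r : ℚ} (a : Dec A) (b : Dec B) (c : Dec C) →
  (A → B × C) → (B × C → A) → (B × C → q ≡ p * r) → iverson a q ≡ iverson b p * iverson c r
iverson-factor a b c to from q≡pr =
  trans (iverson-cong to from q≡pr a (b ×-dec c)) (sym (iverson-product b c _ _))

sumOver-filter : {P : A → Set} (P? : ∀ x → Dec (P x)) (xs : List A) (t : A → ℚ) →
  sumOver (filter P? xs) t ≡ sumOver xs (λ x → iverson (P? x) (t x))
sumOver-filter P? []       t = refl
sumOver-filter P? (x ∷ xs) t with P? x
... | yes _ = cong (t x +_) (sumOver-filter P? xs t)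
... | no _  = trans (sumOver-filter P? xs t) (sym (ℚP.+-identityˡ _))

^-+ : ∀ a m n → a ^ℚ (m ℕ.+ n) ≡ a ^ℚ m * a ^ℚ n
^-+ a zero    n = sym (ℚP.*-identityˡ _)
^-+ a (suc m) n = trans (cong (a *_) (^-+ a m n)) (sym (ℚP.*-assoc a _ _))

*-^ : ∀ a b n → (a * b) ^ℚ n ≡ a ^ℚ n * b ^ℚ n
*-^ a b zero    = refl
*-^ a b (suc n) = trans (cong (a * b *_) (*-^ a b n))
  (solve 4 (λ a b x y → (a :* b) :* (x :* y) := (a :* x) :* (b :* y)) refl a b (a ^ℚ n) (b ^ℚ n))

-- The embedding ℕ → ℚ is additive: both sides normalise the fraction (m + n)/1.
ℕ→ℚ-+ : ∀ m n → ℕ→ℚ (m ℕ.+ n) ≡ ℕ→ℚ m + ℕ→ℚ n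
ℕ→ℚ-+ m n = ℚP.toℚᵘ-injective
  (ℚᵘP.≃-trans (ℚP.toℚᵘ-fromℚᵘ (whole (m ℕ.+ n)))
  (ℚᵘP.≃-trans (ℚᵘ.*≡* sum-cross)
  (ℚᵘP.≃-sym (ℚᵘP.≃-trans (ℚP.toℚᵘ-homo-+ (ℕ→ℚ m) (ℕ→ℚ n))
                           (ℚᵘP.+-cong (ℚP.toℚᵘ-fromℚᵘ (whole m)) (ℚP.toℚᵘ-fromℚᵘ (whole n)))))))
  where
  whole : ℕ → ℚᵘ.ℚᵘ
  whole i = ℚᵘ.mkℚᵘ (ℤ.+ i) 0
  sum-cross : ℤ.+ (m ℕ.+ n) ℤ.* ℤ.+ 1 ≡ (ℤ.+ m ℤ.* ℤ.+ 1 ℤ.+ ℤ.+ n ℤ.* ℤ.+ 1) ℤ.* ℤ.+ 1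
  sum-cross = trans (ℤP.*-identityʳ _)
    (sym (trans (ℤP.*-identityʳ _) (cong₂ ℤ._+_ (ℤP.*-identityʳ (ℤ.+ m)) (ℤP.*-identityʳ (ℤ.+ n)))))

suc-∸ : ∀ {m n} → n ℕ.≤ m → suc m ∸ n ≡ suc (m ∸ n)
suc-∸ = ℕP.+-∸-assoc 1

-- Cutting the segment [b,c] out of [a,d] leaves [a,b] and [c,d].
∸-split : ∀ {a b c d} → a ℕ.≤ b → b ℕ.≤ c → c ℕ.≤ d → (d ∸ a) ∸ (c ∸ b) ≡ (b ∸ a) ℕ.+ (d ∸ c)
∸-split {a} a≤b b≤c c≤d
  with ℕP.m≤n⇒∃[o]m+o≡n a≤b | ℕP.m≤n⇒∃[o]m+o≡n b≤c | ℕP.m≤n⇒∃[o]m+o≡n c≤d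
... | p , refl | q , refl | r , refl = begin
    (a ℕ.+ p ℕ.+ q ℕ.+ r ∸ a) ∸ (a ℕ.+ p ℕ.+ q ∸ (a ℕ.+ p))
      ≡⟨ cong₂ _∸_ (trans (cong (_∸ a) (shape a p q r)) (ℕP.m+n∸m≡n a _)) (ℕP.m+n∸m≡n (a ℕ.+ p) q) ⟩
    (q ℕ.+ (p ℕ.+ r)) ∸ q
      ≡⟨ ℕP.m+n∸m≡n q _ ⟩
    p ℕ.+ r
      ≡⟨ sym (cong₂ ℕ._+_ (ℕP.m+n∸m≡n a p) (ℕP.m+n∸m≡n (a ℕ.+ p ℕ.+ q) r)) ⟩
    (a ℕ.+ p ∸ a) ℕ.+ (a ℕ.+ p ℕ.+ q ℕ.+ r ∸ (a ℕ.+ p ℕ.+ q)) ∎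
  where
  shape : ∀ a p q r → a ℕ.+ p ℕ.+ q ℕ.+ r ≡ a ℕ.+ (q ℕ.+ (p ℕ.+ r))
  shape = solve-∀

-- Words in {0,1,*}^m: the faces of the m-cube

coords : List CubeCoord
coords = c0 ∷ c1 ∷ star ∷ []

coords-unique : Unique coords
coords-unique = ((λ ()) All.∷ (λ ()) All.∷ All.[]) ∷ ((λ ()) All.∷ All.[]) ∷ All.[] ∷ []

coord∈coords : ∀ c → c ∈ coords
coord∈coords c0   = here refl
coord∈coords c1   = there (here refl)
coord∈coords star = there (there (here refl))

_≟c_ : DecidableEquality CubeCoord
c0   ≟c c0   = yes refl
c0   ≟c c1   = no (λ ())
c0   ≟c star = no (λ ())
c1   ≟c c0   = no (λ ())
c1   ≟c c1   = yes refl
c1   ≟c star = no (λ ())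
star ≟c c0   = no (λ ())
star ≟c c1   = no (λ ())
star ≟c star = yes refl

_≟w_ : ∀ {m} → DecidableEquality (Vec CubeCoord m)
_≟w_ = VecP.≡-dec _≟c_

_≤c?_ : (c d : CubeCoord) → Dec (c ≤coord d)
c ≤c? d = (d ≟c star) ⊎-dec (c ≟c d)

_≤w?_ : ∀ {m} (x w : Vec CubeCoord m) → Dec (x ≤cube w)
_≤w?_ = Pointwise.decidable _≤c?_

starCount≤ : ∀ {m} (w : Vec CubeCoord m) → starCount w ℕ.≤ m
starCount≤ []         = ℕ.z≤n
starCount≤ (c0 ∷ w)   = ℕP.m≤n⇒m≤1+n (starCount≤ w)
starCount≤ (c1 ∷ w)   = ℕP.m≤n⇒m≤1+n (starCount≤ w)
starCount≤ (star ∷ w) = ℕ.s≤s (starCount≤ w)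

starCount-mono : ∀ {m} {x w : Vec CubeCoord m} → x ≤cube w → starCount x ℕ.≤ starCount w
starCount-mono []                                 = ℕ.z≤n
starCount-mono {x = c0 ∷ _}   (inj₁ refl ∷ x≤w) = ℕP.m≤n⇒m≤1+n (starCount-mono x≤w)
starCount-mono {x = c1 ∷ _}   (inj₁ refl ∷ x≤w) = ℕP.m≤n⇒m≤1+n (starCount-mono x≤w)
starCount-mono {x = star ∷ _} (inj₁ refl ∷ x≤w) = ℕ.s≤s (starCount-mono x≤w)
starCount-mono {x = c0 ∷ _}   (inj₂ refl ∷ x≤w) = starCount-mono x≤w
starCount-mono {x = c1 ∷ _}   (inj₂ refl ∷ x≤w) = starCount-mono x≤w
starCount-mono {x = star ∷ _} (inj₂ refl ∷ x≤w) = ℕ.s≤s (starCount-mono x≤w)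

sumWords : (m : ℕ) → (Vec CubeCoord m → ℚ) → ℚ
sumWords zero    T = T []
sumWords (suc m) T = sumOver coords (λ c → sumWords m (λ w → T (c ∷ w)))

sumWords-cong : ∀ m {T T′ : Vec CubeCoord m → ℚ} → (∀ w → T w ≡ T′ w) → sumWords m T ≡ sumWords m T′
sumWords-cong zero    h = h []
sumWords-cong (suc m) h = sumOver-cong coords (λ c _ → sumWords-cong m (λ w → h (c ∷ w)))

sumWords-vanish : ∀ m {T : Vec CubeCoord m → ℚ} → (∀ w → T w ≡ 0ℚ) → sumWords m T ≡ 0ℚ
sumWords-vanish zero    h = h []
sumWords-vanish (suc m) h = sumOver-vanish coords (λ c _ → sumWords-vanish m (λ w → h (c ∷ w)))

sumWords-*ˡ : ∀ m c (T : Vec CubeCoord m → ℚ) → c * sumWords m T ≡ sumWords m (λ w → c * T w)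
sumWords-*ˡ zero    c T = refl
sumWords-*ˡ (suc m) c T =
  trans (sumOver-*ˡ coords c (λ d → sumWords m (λ w → T (d ∷ w))))
        (sumOver-cong coords (λ d _ → sumWords-*ˡ m c (λ w → T (d ∷ w))))

iverson-sumWords : (d : Dec A) (m : ℕ) (T : Vec CubeCoord m → ℚ) →
  iverson d (sumWords m T) ≡ sumWords m (λ w → iverson d (T w))
iverson-sumWords (yes _) m T = refl
iverson-sumWords (no _)  m T = sym (sumWords-vanish m (λ _ → refl))

sumOver-sumWords : (xs : List A) (m : ℕ) (t : A → Vec CubeCoord m → ℚ) →
  sumOver xs (λ x → sumWords m (t x)) ≡ sumWords m (λ w → sumOver xs (λ x → t x w))
sumOver-sumWords xs zero    t = refl
sumOver-sumWords xs (suc m) t =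
  trans (sumOver-swap xs coords (λ x c → sumWords m (λ w → t x (c ∷ w))))
        (sumOver-cong coords (λ c _ → sumOver-sumWords xs m (λ x w → t x (c ∷ w))))

sumWords-sift : ∀ m (v : Vec CubeCoord m) (T : Vec CubeCoord m → ℚ) →
  sumWords m (λ w → iverson (w ≟w v) (T w)) ≡ T v
sumWords-sift zero    []      T = refl
sumWords-sift (suc m) (c ∷ v) T = begin
    sumOver coords (λ d → sumWords m (λ w → iverson ((d ∷ w) ≟w (c ∷ v)) (T (d ∷ w))))
      ≡⟨ sumOver-concentrated coords _ c coords-unique (coord∈coords c) other-heads ⟩
    sumWords m (λ w → iverson ((c ∷ w) ≟w (c ∷ v)) (T (c ∷ w)))
      ≡⟨ sumWords-cong m (λ w → iverson-cong VecP.∷-injectiveʳ (cong (c ∷_)) (λ _ → refl)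
                                              ((c ∷ w) ≟w (c ∷ v)) (w ≟w v)) ⟩
    sumWords m (λ w → iverson (w ≟w v) (T (c ∷ w)))
      ≡⟨ sumWords-sift m v (λ w → T (c ∷ w)) ⟩
    T (c ∷ v) ∎
  where
  other-heads : ∀ d → d ∈ coords → ¬ d ≡ c →
    sumWords m (λ w → iverson ((d ∷ w) ≟w (c ∷ v)) (T (d ∷ w))) ≡ 0ℚ
  other-heads d _ d≢c = sumWords-vanish m (λ w → iverson-no (λ eq → d≢c (VecP.∷-injectiveˡ eq))
                                                                    ((d ∷ w) ≟w (c ∷ v)) (T (d ∷ w)))

sumWords-factor : ∀ m (f : CubeCoord → ℚ) (S : Vec CubeCoord (suc m) → ℚ) (T : Vec CubeCoord m → ℚ) →
  (∀ c w → S (c ∷ w) ≡ f c * T w) → sumWords (suc m) S ≡ sumOver coords f * sumWords m T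
sumWords-factor m f S T S≡fT = begin
    sumOver coords (λ c → sumWords m (λ w → S (c ∷ w)))
      ≡⟨ sumOver-cong coords (λ c _ → trans (sumWords-cong m (S≡fT c)) (sym (sumWords-*ˡ m (f c) T))) ⟩
    sumOver coords (λ c → f c * sumWords m T)
      ≡⟨ sym (sumOver-*ʳ coords (sumWords m T) f) ⟩
    sumOver coords f * sumWords m T ∎

module CubeFaces (a b : ℚ) where

  faceWeight : (m : ℕ) → Vec CubeCoord m → ℚ
  faceWeight m w = a ^ℚ (m ∸ starCount w) * b ^ℚ starCount w

  coordFaceWeight : CubeCoord → ℚ
  coordFaceWeight star = b
  coordFaceWeight _    = a

  fixedCoord : ∀ m (w : Vec CubeCoord m) →
    a ^ℚ (suc m ∸ starCount w) * b ^ℚ starCount w ≡ a * faceWeight m w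
  fixedCoord m w = trans (cong (λ e → a ^ℚ e * b ^ℚ starCount w) (suc-∸ (starCount≤ w)))
                         (ℚP.*-assoc a (a ^ℚ (m ∸ starCount w)) (b ^ℚ starCount w))

  faceWeight-∷ : ∀ m c w → faceWeight (suc m) (c ∷ w) ≡ coordFaceWeight c * faceWeight m w
  faceWeight-∷ m c0   w = fixedCoord m w
  faceWeight-∷ m c1   w = fixedCoord m w
  faceWeight-∷ m star w =
    solve 3 (λ p b q → p :* (b :* q) := b :* (p :* q)) refl (a ^ℚ (m ∸ starCount w)) b (b ^ℚ starCount w)

  cubeFaceSum : ∀ m → sumWords m (faceWeight m) ≡ (a + (a + b)) ^ℚ m
  cubeFaceSum zero    = ℚP.*-identityˡ 1ℚ
  cubeFaceSum (suc m) = begin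
      sumWords (suc m) (faceWeight (suc m))
        ≡⟨ sumWords-factor m coordFaceWeight (faceWeight (suc m)) (faceWeight m) (faceWeight-∷ m) ⟩
      (a + (a + (b + 0ℚ))) * sumWords m (faceWeight m)
        ≡⟨ cong₂ _*_ (cong (λ z → a + (a + z)) (ℚP.+-identityʳ b)) (cubeFaceSum m) ⟩
      (a + (a + b)) ^ℚ suc m ∎

module CubeIntervals (u v : ℚ) where

  intervalWeight : (m : ℕ) → Vec CubeCoord m → Vec CubeCoord m → ℚ
  intervalWeight m x w = iverson (x ≤w? w) (u ^ℚ (starCount w ∸ starCount x) * v ^ℚ (m ∸ starCount w))

  -- contribution of one coordinate pair c ≤ d: u for a new star, 1 for an
  -- old star, v for a coordinate that stays fixed
  coordStep : CubeCoord → CubeCoord → ℚ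
  coordStep star star = 1ℚ
  coordStep _    star = u
  coordStep _    _    = v

  coordWeight : CubeCoord → CubeCoord → ℚ
  coordWeight c d = iverson (c ≤c? d) (coordStep c d)

  newStar : ∀ {m} {x w : Vec CubeCoord m} → x ≤cube w →
    u ^ℚ (suc (starCount w) ∸ starCount x) * v ^ℚ (m ∸ starCount w)
      ≡ u * (u ^ℚ (starCount w ∸ starCount x) * v ^ℚ (m ∸ starCount w))
  newStar {m} {x} {w} x≤w =
    trans (cong (λ e → u ^ℚ e * v ^ℚ (m ∸ starCount w)) (suc-∸ (starCount-mono x≤w)))
          (ℚP.*-assoc u (u ^ℚ (starCount w ∸ starCount x)) (v ^ℚ (m ∸ starCount w)))

  fixedCoord : ∀ {m} (x w : Vec CubeCoord m) →
    u ^ℚ (starCount w ∸ starCount x) * v ^ℚ (suc m ∸ starCount w)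
      ≡ v * (u ^ℚ (starCount w ∸ starCount x) * v ^ℚ (m ∸ starCount w))
  fixedCoord {m} x w =
    trans (cong (λ e → u ^ℚ (starCount w ∸ starCount x) * v ^ℚ e) (suc-∸ (starCount≤ w)))
          (solve 3 (λ p v q → p :* (v :* q) := v :* (p :* q)) refl
                 (u ^ℚ (starCount w ∸ starCount x)) v (v ^ℚ (m ∸ starCount w)))

  coordSplit : ∀ {m c d} {x w : Vec CubeCoord m} → c ≤coord d → x ≤cube w →
    u ^ℚ (starCount (d ∷ w) ∸ starCount (c ∷ x)) * v ^ℚ (suc m ∸ starCount (d ∷ w))
      ≡ coordStep c d * (u ^ℚ (starCount w ∸ starCount x) * v ^ℚ (m ∸ starCount w))
  coordSplit {c = c0}   (inj₁ refl) x≤w = newStar x≤w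
  coordSplit {c = c1}   (inj₁ refl) x≤w = newStar x≤w
  coordSplit {c = star} (inj₁ refl) x≤w = sym (ℚP.*-identityˡ _)
  coordSplit {c = c0}   {x = x} {w} (inj₂ refl) _ = fixedCoord x w
  coordSplit {c = c1}   {x = x} {w} (inj₂ refl) _ = fixedCoord x w
  coordSplit {c = star} (inj₂ refl) x≤w = sym (ℚP.*-identityˡ _)

  intervalWeight-∷ : ∀ m c d (x w : Vec CubeCoord m) →
    intervalWeight (suc m) (c ∷ x) (d ∷ w) ≡ coordWeight c d * intervalWeight m x w
  intervalWeight-∷ m c d x w =
    iverson-factor ((c ∷ x) ≤w? (d ∷ w)) (c ≤c? d) (x ≤w? w)
      (λ { (c≤d ∷ x≤w) → c≤d , x≤w }) (λ (c≤d , x≤w) → c≤d ∷ x≤w) (λ (c≤d , x≤w) → coordSplit c≤d x≤w)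

  -- summing over the upper coordinate: (u + v) per fixed coordinate of x
  coordSum : ∀ {m} c (x : Vec CubeCoord m) →
    sumOver coords (coordWeight c) * (u + v) ^ℚ (m ∸ starCount x) ≡ (u + v) ^ℚ (suc m ∸ starCount (c ∷ x))
  coordSum {m} c0 x =
    trans (solve 3 (λ u v P → (v :+ (con 0ℚ :+ (u :+ con 0ℚ))) :* P := (u :+ v) :* P) refl u v _)
          (cong ((u + v) ^ℚ_) (sym (suc-∸ (starCount≤ x))))
  coordSum {m} c1 x =
    trans (solve 3 (λ u v P → (con 0ℚ :+ (v :+ (u :+ con 0ℚ))) :* P := (u :+ v) :* P) refl u v _)
          (cong ((u + v) ^ℚ_) (sym (suc-∸ (starCount≤ x))))
  coordSum star x = solve 1 (λ P → (con 0ℚ :+ (con 0ℚ :+ (con 1ℚ :+ con 0ℚ))) :* P := P) refl _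

  cubeIntervalSum : ∀ m (x : Vec CubeCoord m) → sumWords m (intervalWeight m x) ≡ (u + v) ^ℚ (m ∸ starCount x)
  cubeIntervalSum zero    []      = ℚP.*-identityˡ 1ℚ
  cubeIntervalSum (suc m) (c ∷ x) = begin
      sumWords (suc m) (intervalWeight (suc m) (c ∷ x))
        ≡⟨ sumWords-factor m (coordWeight c) (intervalWeight (suc m) (c ∷ x)) (intervalWeight m x)
                                (λ d w → intervalWeight-∷ m c d x w) ⟩
      sumOver coords (coordWeight c) * sumWords m (intervalWeight m x)
        ≡⟨ cong (sumOver coords (coordWeight c) *_) (cubeIntervalSum m x) ⟩
      sumOver coords (coordWeight c) * (u + v) ^ℚ (m ∸ starCount x)
        ≡⟨ coordSum c x ⟩
      (u + v) ^ℚ (suc m ∸ starCount (c ∷ x)) ∎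

-- Cubical posets

-- The two counting properties of face posets of cubical complexes on which
-- the proof rests: every lower interval [·,G] has the face numbers of a
-- (dim G)-cube, and every closed interval [F,G] is boolean of rank dim G - dim F.
record IsCubicalPoset (P : FacePoset) : Set where
  open FacePoset P
  field
    ≤-trans  : ∀ {F G H} → F ≤ G → G ≤ H → F ≤ H
    dim-mono : ∀ F G → F ∈ faces → G ∈ faces → F ≤ G → dim F ℕ.≤ dim G
    lowerSum : ∀ G → G ∈ faces → ∀ a b →
      sumOver faces (λ F → iverson (F ≤? G) (a ^ℚ (dim G ∸ dim F) * b ^ℚ dim F)) ≡ (a + (a + b)) ^ℚ dim G
    intervalSum : ∀ F G → F ∈ faces → G ∈ faces → F ≤ G → ∀ u v →
      sumOver faces (λ H → iverson ((F ≤? H) ×-dec (H ≤? G)) (u ^ℚ (dim H ∸ dim F) * v ^ℚ (dim G ∸ dim H)))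
        ≡ (u + v) ^ℚ (dim G ∸ dim F)

DimBound : FacePoset → ℕ → Set
DimBound P k = ∀ F → F ∈ faces → dim F ℕ.≤ k
  where open FacePoset P

faceSum : FacePoset → ℕ → ℚ → ℚ → ℚ
faceSum P k a b = sumOver faces (λ F → a ^ℚ dim F * b ^ℚ (k ∸ dim F))
  where open FacePoset P

-- A chart of a face G identifies its faces with the words of the (dim G)-cube,
-- so sums over the faces of G become sums over words.
module Chart (P : FacePoset) {G : FacePoset.Face P} (chart : CubeIso P G)
             (faces-unique : Unique (FacePoset.faces P)) where
  open FacePoset P
  open CubeIso chart

  chartSum : (T : Vec CubeCoord (dim G) → ℚ) →
    sumOver faces (λ H → iverson (H ≤? G) (T (φ H))) ≡ sumWords (dim G) T
  chartSum T = begin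
      sumOver faces (λ H → iverson (H ≤? G) (T (φ H)))
        ≡⟨ sumOver-cong faces (λ H _ → cong (iverson (H ≤? G)) (sym (sumWords-sift (dim G) (φ H) T))) ⟩
      sumOver faces (λ H → iverson (H ≤? G) (sumWords (dim G) (λ w → iverson (w ≟w φ H) (T w))))
        ≡⟨ sumOver-cong faces (λ H _ → iverson-sumWords (H ≤? G) (dim G) _) ⟩
      sumOver faces (λ H → sumWords (dim G) (λ w → iverson (H ≤? G) (iverson (w ≟w φ H) (T w))))
        ≡⟨ sumOver-sumWords faces (dim G) _ ⟩
      sumWords (dim G) (λ w → sumOver faces (λ H → iverson (H ≤? G) (iverson (w ≟w φ H) (T w))))
        ≡⟨ sumWords-cong (dim G) (λ w → sumOver-concentrated faces _ (ψ w) faces-unique (ψ-face w) (others w)) ⟩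
      sumWords (dim G) (λ w → iverson (ψ w ≤? G) (iverson (w ≟w φ (ψ w)) (T w)))
        ≡⟨ sumWords-cong (dim G) (λ w → trans (iverson-yes (ψ-below w) (ψ w ≤? G) _)
                                              (iverson-yes (sym (φψ w)) (w ≟w φ (ψ w)) (T w))) ⟩
      sumWords (dim G) T ∎
    where
    -- only the face with coordinates w contributes to the inner sum
    others : ∀ w H → H ∈ faces → ¬ H ≡ ψ w →
      iverson (H ≤? G) (iverson (w ≟w φ H) (T w)) ≡ 0ℚ
    others w H H∈ H≢ψw with H ≤? G
    ... | no _    = refl
    ... | yes H≤G = iverson-no (λ w≡φH → H≢ψw (trans (sym (ψφ H H∈ H≤G)) (cong ψ (sym w≡φH))))
                               (w ≟w φ H) (T w)

-- The face poset of a cubical complex is a cubical poset: through the chart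
-- of G both sums become the cube computations cubeFaceSum and cubeIntervalSum.
isCubicalPoset-complex : ∀ K → IsCubicalComplex K → IsCubicalPoset K
isCubicalPoset-complex K cc = record
  { ≤-trans     = IsPartialOrder.trans partialOrder
  ; dim-mono    = dim-mono
  ; lowerSum    = lowerSum
  ; intervalSum = intervalSum
  }
  where
  open FacePoset K
  open IsCubicalComplex cc

  dim-mono : ∀ F G → F ∈ faces → G ∈ faces → F ≤ G → dim F ℕ.≤ dim G
  dim-mono F G F∈ G∈ F≤G = subst (ℕ._≤ dim G) (sym (dim-φ F F∈ F≤G)) (starCount≤ (φ F))
    where open CubeIso (cube G G∈)

  lowerSum : ∀ G → G ∈ faces → ∀ a b →
    sumOver faces (λ F → iverson (F ≤? G) (a ^ℚ (dim G ∸ dim F) * b ^ℚ dim F)) ≡ (a + (a + b)) ^ℚ dim G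
  lowerSum G G∈ a b = begin
      sumOver faces (λ F → iverson (F ≤? G) (a ^ℚ (dim G ∸ dim F) * b ^ℚ dim F))
        ≡⟨ sumOver-cong faces (λ F F∈ → iverson-cong id id (inChart F F∈) (F ≤? G) (F ≤? G)) ⟩
      sumOver faces (λ F → iverson (F ≤? G) (faceWeight (dim G) (φ F)))
        ≡⟨ chartSum (faceWeight (dim G)) ⟩
      sumWords (dim G) (faceWeight (dim G))
        ≡⟨ cubeFaceSum (dim G) ⟩
      (a + (a + b)) ^ℚ dim G ∎
    where
    open CubeIso (cube G G∈)
    open Chart K (cube G G∈) unique
    open CubeFaces a b
    inChart : ∀ F → F ∈ faces → F ≤ G →
      a ^ℚ (dim G ∸ dim F) * b ^ℚ dim F ≡ faceWeight (dim G) (φ F)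
    inChart F F∈ F≤G = cong (λ e → a ^ℚ (dim G ∸ e) * b ^ℚ e) (dim-φ F F∈ F≤G)

  intervalSum : ∀ F G → F ∈ faces → G ∈ faces → F ≤ G → ∀ u v →
    sumOver faces (λ H → iverson ((F ≤? H) ×-dec (H ≤? G)) (u ^ℚ (dim H ∸ dim F) * v ^ℚ (dim G ∸ dim H)))
      ≡ (u + v) ^ℚ (dim G ∸ dim F)
  intervalSum F G F∈ G∈ F≤G u v = begin
      sumOver faces (λ H → iverson ((F ≤? H) ×-dec (H ≤? G)) (u ^ℚ (dim H ∸ dim F) * v ^ℚ (dim G ∸ dim H)))
        ≡⟨ sumOver-cong faces (λ H H∈ → trans (iverson-cong (to H H∈) (from H H∈) (inChart H H∈)
                                                             ((F ≤? H) ×-dec (H ≤? G)) ((H ≤? G) ×-dec (φ F ≤w? φ H)))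
                                               (sym (iverson-nested (H ≤? G) (φ F ≤w? φ H) _))) ⟩
      sumOver faces (λ H → iverson (H ≤? G) (intervalWeight (dim G) (φ F) (φ H)))
        ≡⟨ chartSum (intervalWeight (dim G) (φ F)) ⟩
      sumWords (dim G) (intervalWeight (dim G) (φ F))
        ≡⟨ cubeIntervalSum (dim G) (φ F) ⟩
      (u + v) ^ℚ (dim G ∸ starCount (φ F))
        ≡⟨ cong (λ e → (u + v) ^ℚ (dim G ∸ e)) (sym (dim-φ F F∈ F≤G)) ⟩
      (u + v) ^ℚ (dim G ∸ dim F) ∎
    where
    open CubeIso (cube G G∈)
    open Chart K (cube G G∈) unique
    open CubeIntervals u v
    to : ∀ H → H ∈ faces → F ≤ H × H ≤ G → H ≤ G × φ F ≤cube φ H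
    to H H∈ (F≤H , H≤G) = H≤G , mono F H F∈ F≤G H∈ H≤G F≤H
    from : ∀ H → H ∈ faces → H ≤ G × φ F ≤cube φ H → F ≤ H × H ≤ G
    from H H∈ (H≤G , φF≤φH) = reflect F H F∈ F≤G H∈ H≤G φF≤φH , H≤G
    inChart : ∀ H → H ∈ faces → H ≤ G × φ F ≤cube φ H →
      u ^ℚ (dim H ∸ dim F) * v ^ℚ (dim G ∸ dim H)
        ≡ u ^ℚ (starCount (φ H) ∸ starCount (φ F)) * v ^ℚ (dim G ∸ starCount (φ H))
    inChart H H∈ (H≤G , _) =
      cong₂ (λ e f → u ^ℚ (f ∸ e) * v ^ℚ (dim G ∸ f)) (dim-φ F F∈ F≤G) (dim-φ H H∈ H≤G)

-- Cubical barycentric subdivision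

-- The faces of sd_c P are the intervals [F,G] of P; an interval of sd_c P
-- below [F,G], or between two of its faces, is a product of intervals of P.
module Subdivision (P : FacePoset) (cp : IsCubicalPoset P) where
  open FacePoset P
  open IsCubicalPoset cp
  module S = FacePoset (sdc P)

  ∈-sdc : ∀ {F G} → (F , G) ∈ S.faces → F ∈ faces × G ∈ faces × F ≤ G
  ∈-sdc FG∈ with ∈-filter⁻ (λ p → proj₁ p ≤? proj₂ p) FG∈
  ... | FG∈faces² , F≤G with ∈-cartesianProduct⁻ faces faces FG∈faces²
  ...   | F∈ , G∈ = F∈ , G∈ , F≤G

  sumOver-sdc : (t : Face × Face → ℚ) →
    sumOver S.faces t ≡ sumOver faces (λ F → sumOver faces (λ G → iverson (F ≤? G) (t (F , G))))
  sumOver-sdc t = trans (sumOver-filter (λ p → proj₁ p ≤? proj₂ p) (cartesianProduct faces faces) t)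
                        (sumOver-cartesianProduct faces faces _)

  -- dim [F,G] = dim G - dim F ≤ dim G
  dimBound-sdc : ∀ {k} → DimBound P k → DimBound (sdc P) k
  dimBound-sdc bound (F , G) FG∈ = ℕP.≤-trans (ℕP.m∸n≤m (dim G) (dim F)) (bound G (proj₁ (proj₂ (∈-sdc FG∈))))

  dim-gap : ∀ {F F′ G′ G} → F ∈ faces → F′ ∈ faces → G′ ∈ faces → G ∈ faces → F ≤ F′ → F′ ≤ G′ → G′ ≤ G →
    (dim G ∸ dim F) ∸ (dim G′ ∸ dim F′) ≡ (dim F′ ∸ dim F) ℕ.+ (dim G ∸ dim G′)
  dim-gap F∈ F′∈ G′∈ G∈ F≤F′ F′≤G′ G′≤G =
    ∸-split (dim-mono _ _ F∈ F′∈ F≤F′) (dim-mono _ _ F′∈ G′∈ F′≤G′) (dim-mono _ _ G′∈ G∈ G′≤G)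

  -- [F,G] contains [F′,G′] iff F ≤ F′ ≤ G′ ≤ G; summing first over G′ uses the
  -- boolean interval [F′,G], then over F′ the boolean interval [F,G].
  lowerSum-sdc : ∀ X → X ∈ S.faces → ∀ a b →
    sumOver S.faces (λ Y → iverson (Y S.≤? X) (a ^ℚ (S.dim X ∸ S.dim Y) * b ^ℚ S.dim Y)) ≡ (a + (a + b)) ^ℚ S.dim X
  lowerSum-sdc (F , G) FG∈ a b = begin
      sumOver S.faces (λ Y → iverson (Y S.≤? (F , G)) (a ^ℚ ((dim G ∸ dim F) ∸ S.dim Y) * b ^ℚ S.dim Y))
        ≡⟨ sumOver-sdc _ ⟩
      sumOver faces (λ F′ → sumOver faces (λ G′ → iverson (F′ ≤? G′) (iverson ((F ≤? F′) ×-dec (G′ ≤? G)) (term F′ G′))))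
        ≡⟨ sumOver-cong faces (λ F′ F′∈ → sumOver-cong faces (λ G′ G′∈ → split F′ G′ F′∈ G′∈)) ⟩
      sumOver faces (λ F′ → sumOver faces (λ G′ → below F′ * above F′ G′))
        ≡⟨ sumOver-cong faces (λ F′ _ → sym (sumOver-*ˡ faces (below F′) (above F′))) ⟩
      sumOver faces (λ F′ → below F′ * sumOver faces (above F′))
        ≡⟨ sumOver-cong faces (λ F′ F′∈ → iverson-*-when ((F ≤? F′) ×-dec (F′ ≤? G)) (a ^ℚ (dim F′ ∸ dim F)) _
                                            (λ (_ , F′≤G) → intervalSum F′ G F′∈ G∈ F′≤G b a)) ⟩
      sumOver faces (λ F′ → iverson ((F ≤? F′) ×-dec (F′ ≤? G)) (a ^ℚ (dim F′ ∸ dim F) * (b + a) ^ℚ (dim G ∸ dim F′)))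
        ≡⟨ intervalSum F G F∈ G∈ F≤G a (b + a) ⟩
      (a + (b + a)) ^ℚ (dim G ∸ dim F)
        ≡⟨ cong (λ z → (a + z) ^ℚ (dim G ∸ dim F)) (ℚP.+-comm b a) ⟩
      (a + (a + b)) ^ℚ (dim G ∸ dim F) ∎
    where
    F∈ = proj₁ (∈-sdc FG∈)
    G∈ = proj₁ (proj₂ (∈-sdc FG∈))
    F≤G = proj₂ (proj₂ (∈-sdc FG∈))
    term : Face → Face → ℚ
    term F′ G′ = a ^ℚ ((dim G ∸ dim F) ∸ (dim G′ ∸ dim F′)) * b ^ℚ (dim G′ ∸ dim F′)
    below : Face → ℚ
    below F′ = iverson ((F ≤? F′) ×-dec (F′ ≤? G)) (a ^ℚ (dim F′ ∸ dim F))
    above : Face → Face → ℚ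
    above F′ G′ = iverson ((F′ ≤? G′) ×-dec (G′ ≤? G)) (b ^ℚ (dim G′ ∸ dim F′) * a ^ℚ (dim G ∸ dim G′))
    termSplit : ∀ F′ G′ → F′ ∈ faces → G′ ∈ faces → F ≤ F′ → F′ ≤ G′ → G′ ≤ G →
      term F′ G′ ≡ a ^ℚ (dim F′ ∸ dim F) * (b ^ℚ (dim G′ ∸ dim F′) * a ^ℚ (dim G ∸ dim G′))
    termSplit F′ G′ F′∈ G′∈ F≤F′ F′≤G′ G′≤G = begin
        term F′ G′
          ≡⟨ cong (λ e → a ^ℚ e * b ^ℚ (dim G′ ∸ dim F′)) (dim-gap F∈ F′∈ G′∈ G∈ F≤F′ F′≤G′ G′≤G) ⟩
        a ^ℚ ((dim F′ ∸ dim F) ℕ.+ (dim G ∸ dim G′)) * b ^ℚ (dim G′ ∸ dim F′)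
          ≡⟨ cong (_* b ^ℚ (dim G′ ∸ dim F′)) (^-+ a (dim F′ ∸ dim F) (dim G ∸ dim G′)) ⟩
        a ^ℚ (dim F′ ∸ dim F) * a ^ℚ (dim G ∸ dim G′) * b ^ℚ (dim G′ ∸ dim F′)
          ≡⟨ solve 3 (λ x y z → x :* y :* z := x :* (z :* y)) refl
               (a ^ℚ (dim F′ ∸ dim F)) (a ^ℚ (dim G ∸ dim G′)) (b ^ℚ (dim G′ ∸ dim F′)) ⟩
        a ^ℚ (dim F′ ∸ dim F) * (b ^ℚ (dim G′ ∸ dim F′) * a ^ℚ (dim G ∸ dim G′)) ∎
    split : ∀ F′ G′ → F′ ∈ faces → G′ ∈ faces →
      iverson (F′ ≤? G′) (iverson ((F ≤? F′) ×-dec (G′ ≤? G)) (term F′ G′)) ≡ below F′ * above F′ G′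
    split F′ G′ F′∈ G′∈ = trans (iverson-nested (F′ ≤? G′) ((F ≤? F′) ×-dec (G′ ≤? G)) (term F′ G′))
      (iverson-factor ((F′ ≤? G′) ×-dec ((F ≤? F′) ×-dec (G′ ≤? G))) ((F ≤? F′) ×-dec (F′ ≤? G)) ((F′ ≤? G′) ×-dec (G′ ≤? G))
        (λ (F′≤G′ , F≤F′ , G′≤G) → (F≤F′ , ≤-trans F′≤G′ G′≤G) , (F′≤G′ , G′≤G))
        (λ ((F≤F′ , _) , (F′≤G′ , G′≤G)) → F′≤G′ , F≤F′ , G′≤G)
        (λ ((F≤F′ , _) , (F′≤G′ , G′≤G)) → termSplit F′ G′ F′∈ G′∈ F≤F′ F′≤G′ G′≤G))

  -- [A,B] ⊆ [F,G] ⊆ [C,D] iff C ≤ F ≤ A and B ≤ G ≤ D, so this interval of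
  -- sd_c P is the product of the boolean intervals [C,A] and [B,D] of P.
  intervalSum-sdc : ∀ X Y → X ∈ S.faces → Y ∈ S.faces → X S.≤ Y → ∀ u v →
    sumOver S.faces (λ Z → iverson ((X S.≤? Z) ×-dec (Z S.≤? Y)) (u ^ℚ (S.dim Z ∸ S.dim X) * v ^ℚ (S.dim Y ∸ S.dim Z)))
      ≡ (u + v) ^ℚ (S.dim Y ∸ S.dim X)
  intervalSum-sdc (A , B) (C , D) AB∈ CD∈ (C≤A , B≤D) u v = begin
      sumOver S.faces (λ Z → iverson (((A , B) S.≤? Z) ×-dec (Z S.≤? (C , D)))
                               (u ^ℚ (S.dim Z ∸ (dim B ∸ dim A)) * v ^ℚ ((dim D ∸ dim C) ∸ S.dim Z)))
        ≡⟨ sumOver-sdc _ ⟩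
      sumOver faces (λ F → sumOver faces (λ G → iverson (F ≤? G)
        (iverson (((F ≤? A) ×-dec (B ≤? G)) ×-dec ((C ≤? F) ×-dec (G ≤? D))) (term F G))))
        ≡⟨ sumOver-cong faces (λ F F∈ → sumOver-cong faces (λ G G∈ → split F G F∈ G∈)) ⟩
      sumOver faces (λ F → sumOver faces (λ G → lower F * upper G))
        ≡⟨ sumOver-cong faces (λ F _ → sym (sumOver-*ˡ faces (lower F) upper)) ⟩
      sumOver faces (λ F → lower F * sumOver faces upper)
        ≡⟨ sym (sumOver-*ʳ faces (sumOver faces upper) lower) ⟩
      sumOver faces lower * sumOver faces upper
        ≡⟨ cong₂ _*_ (intervalSum C A C∈ A∈ C≤A v u) (intervalSum B D B∈ D∈ B≤D u v) ⟩
      (v + u) ^ℚ (dim A ∸ dim C) * (u + v) ^ℚ (dim D ∸ dim B)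
        ≡⟨ cong (λ s → s ^ℚ (dim A ∸ dim C) * (u + v) ^ℚ (dim D ∸ dim B)) (ℚP.+-comm v u) ⟩
      (u + v) ^ℚ (dim A ∸ dim C) * (u + v) ^ℚ (dim D ∸ dim B)
        ≡⟨ sym (^-+ (u + v) (dim A ∸ dim C) (dim D ∸ dim B)) ⟩
      (u + v) ^ℚ ((dim A ∸ dim C) ℕ.+ (dim D ∸ dim B))
        ≡⟨ cong ((u + v) ^ℚ_) (sym (dim-gap C∈ A∈ B∈ D∈ C≤A A≤B B≤D)) ⟩
      (u + v) ^ℚ ((dim D ∸ dim C) ∸ (dim B ∸ dim A)) ∎
    where
    A∈ = proj₁ (∈-sdc AB∈)
    B∈ = proj₁ (proj₂ (∈-sdc AB∈))
    A≤B = proj₂ (proj₂ (∈-sdc AB∈))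
    C∈ = proj₁ (∈-sdc CD∈)
    D∈ = proj₁ (proj₂ (∈-sdc CD∈))
    term : Face → Face → ℚ
    term F G = u ^ℚ ((dim G ∸ dim F) ∸ (dim B ∸ dim A)) * v ^ℚ ((dim D ∸ dim C) ∸ (dim G ∸ dim F))
    lower : Face → ℚ
    lower F = iverson ((C ≤? F) ×-dec (F ≤? A)) (v ^ℚ (dim F ∸ dim C) * u ^ℚ (dim A ∸ dim F))
    upper : Face → ℚ
    upper G = iverson ((B ≤? G) ×-dec (G ≤? D)) (u ^ℚ (dim G ∸ dim B) * v ^ℚ (dim D ∸ dim G))
    termSplit : ∀ F G → F ∈ faces → G ∈ faces → C ≤ F → F ≤ A → B ≤ G → G ≤ D →
      term F G ≡ (v ^ℚ (dim F ∸ dim C) * u ^ℚ (dim A ∸ dim F)) * (u ^ℚ (dim G ∸ dim B) * v ^ℚ (dim D ∸ dim G))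
    termSplit F G F∈ G∈ C≤F F≤A B≤G G≤D = begin
        term F G
          ≡⟨ cong₂ (λ e f → u ^ℚ e * v ^ℚ f) (dim-gap F∈ A∈ B∈ G∈ F≤A A≤B B≤G)
                   (dim-gap C∈ F∈ G∈ D∈ C≤F (≤-trans F≤A (≤-trans A≤B B≤G)) G≤D) ⟩
        u ^ℚ ((dim A ∸ dim F) ℕ.+ (dim G ∸ dim B)) * v ^ℚ ((dim F ∸ dim C) ℕ.+ (dim D ∸ dim G))
          ≡⟨ cong₂ _*_ (^-+ u (dim A ∸ dim F) (dim G ∸ dim B)) (^-+ v (dim F ∸ dim C) (dim D ∸ dim G)) ⟩
        (u ^ℚ (dim A ∸ dim F) * u ^ℚ (dim G ∸ dim B)) * (v ^ℚ (dim F ∸ dim C) * v ^ℚ (dim D ∸ dim G))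
          ≡⟨ solve 4 (λ x y z w → (x :* y) :* (z :* w) := (z :* x) :* (y :* w)) refl
               (u ^ℚ (dim A ∸ dim F)) (u ^ℚ (dim G ∸ dim B)) (v ^ℚ (dim F ∸ dim C)) (v ^ℚ (dim D ∸ dim G)) ⟩
        (v ^ℚ (dim F ∸ dim C) * u ^ℚ (dim A ∸ dim F)) * (u ^ℚ (dim G ∸ dim B) * v ^ℚ (dim D ∸ dim G)) ∎
    split : ∀ F G → F ∈ faces → G ∈ faces →
      iverson (F ≤? G) (iverson (((F ≤? A) ×-dec (B ≤? G)) ×-dec ((C ≤? F) ×-dec (G ≤? D))) (term F G))
        ≡ lower F * upper G
    split F G F∈ G∈ = trans (iverson-nested (F ≤? G) (((F ≤? A) ×-dec (B ≤? G)) ×-dec ((C ≤? F) ×-dec (G ≤? D))) (term F G))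
      (iverson-factor ((F ≤? G) ×-dec (((F ≤? A) ×-dec (B ≤? G)) ×-dec ((C ≤? F) ×-dec (G ≤? D))))
                      ((C ≤? F) ×-dec (F ≤? A)) ((B ≤? G) ×-dec (G ≤? D))
        (λ (_ , (F≤A , B≤G) , (C≤F , G≤D)) → (C≤F , F≤A) , (B≤G , G≤D))
        (λ ((C≤F , F≤A) , (B≤G , G≤D)) → ≤-trans F≤A (≤-trans A≤B B≤G) , (F≤A , B≤G) , (C≤F , G≤D))
        (λ ((C≤F , F≤A) , (B≤G , G≤D)) → termSplit F G F∈ G∈ C≤F F≤A B≤G G≤D))

  isCubicalPoset-sdc : IsCubicalPoset (sdc P)
  isCubicalPoset-sdc = record
    { ≤-trans     = λ (F′≤F , G≤G′) (F″≤F′ , G′≤G″) → ≤-trans F″≤F′ F′≤F , ≤-trans G≤G′ G′≤G″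
    ; dim-mono    = dim-mono-sdc
    ; lowerSum    = lowerSum-sdc
    ; intervalSum = intervalSum-sdc
    }
    where
    dim-mono-sdc : ∀ X Y → X ∈ S.faces → Y ∈ S.faces → X S.≤ Y → S.dim X ℕ.≤ S.dim Y
    dim-mono-sdc (F , G) (F′ , G′) FG∈ F′G′∈ (F′≤F , G≤G′) =
      ℕP.∸-mono (dim-mono G G′ (proj₁ (proj₂ (∈-sdc FG∈))) (proj₁ (proj₂ (∈-sdc F′G′∈))) G≤G′)
                (dim-mono F′ F (proj₁ (∈-sdc F′G′∈)) (proj₁ (∈-sdc FG∈)) F′≤F)

  -- E_{sd_c P}(a,b) = E_P(2a + b, b): group the intervals [F,G] by their top G;
  -- the intervals with top G contribute b^{k - dim G}(2a + b)^{dim G} by lowerSum.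
  faceSum-sdc : ∀ {k} → DimBound P k → ∀ a b → faceSum (sdc P) k a b ≡ faceSum P k (a + (a + b)) b
  faceSum-sdc {k} bound a b = begin
      faceSum (sdc P) k a b
        ≡⟨ sumOver-sdc _ ⟩
      sumOver faces (λ F → sumOver faces (λ G → iverson (F ≤? G) (a ^ℚ (dim G ∸ dim F) * b ^ℚ (k ∸ (dim G ∸ dim F)))))
        ≡⟨ sumOver-swap faces faces _ ⟩
      sumOver faces (λ G → sumOver faces (λ F → iverson (F ≤? G) (a ^ℚ (dim G ∸ dim F) * b ^ℚ (k ∸ (dim G ∸ dim F)))))
        ≡⟨ sumOver-cong faces (λ G G∈ → intervalsWithTop G G∈) ⟩
      faceSum P k (a + (a + b)) b ∎
    where
    intervalsWithTop : ∀ G → G ∈ faces →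
      sumOver faces (λ F → iverson (F ≤? G) (a ^ℚ (dim G ∸ dim F) * b ^ℚ (k ∸ (dim G ∸ dim F))))
        ≡ (a + (a + b)) ^ℚ dim G * b ^ℚ (k ∸ dim G)
    intervalsWithTop G G∈ = begin
        sumOver faces (λ F → iverson (F ≤? G) (a ^ℚ (dim G ∸ dim F) * b ^ℚ (k ∸ (dim G ∸ dim F))))
          ≡⟨ sumOver-cong faces (λ F F∈ → trans (iverson-cong id id (regroup F F∈) (F ≤? G) (F ≤? G))
                                                (iverson-*ˡ (F ≤? G) (b ^ℚ (k ∸ dim G)) _)) ⟩
        sumOver faces (λ F → b ^ℚ (k ∸ dim G) * iverson (F ≤? G) (a ^ℚ (dim G ∸ dim F) * b ^ℚ dim F))
          ≡⟨ sym (sumOver-*ˡ faces (b ^ℚ (k ∸ dim G)) _) ⟩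
        b ^ℚ (k ∸ dim G) * sumOver faces (λ F → iverson (F ≤? G) (a ^ℚ (dim G ∸ dim F) * b ^ℚ dim F))
          ≡⟨ cong (b ^ℚ (k ∸ dim G) *_) (lowerSum G G∈ a b) ⟩
        b ^ℚ (k ∸ dim G) * (a + (a + b)) ^ℚ dim G
          ≡⟨ ℚP.*-comm (b ^ℚ (k ∸ dim G)) _ ⟩
        (a + (a + b)) ^ℚ dim G * b ^ℚ (k ∸ dim G) ∎
      where
      -- k - (dim G - dim F) = dim F + (k - dim G)
      regroup : ∀ F → F ∈ faces → F ≤ G →
        a ^ℚ (dim G ∸ dim F) * b ^ℚ (k ∸ (dim G ∸ dim F)) ≡ b ^ℚ (k ∸ dim G) * (a ^ℚ (dim G ∸ dim F) * b ^ℚ dim F)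
      regroup F F∈ F≤G = begin
          a ^ℚ (dim G ∸ dim F) * b ^ℚ (k ∸ (dim G ∸ dim F))
            ≡⟨ cong (λ e → a ^ℚ (dim G ∸ dim F) * b ^ℚ e) (∸-split ℕ.z≤n (dim-mono F G F∈ G∈ F≤G) (bound G G∈)) ⟩
          a ^ℚ (dim G ∸ dim F) * b ^ℚ (dim F ℕ.+ (k ∸ dim G))
            ≡⟨ cong (a ^ℚ (dim G ∸ dim F) *_) (^-+ b (dim F) (k ∸ dim G)) ⟩
          a ^ℚ (dim G ∸ dim F) * (b ^ℚ dim F * b ^ℚ (k ∸ dim G))
            ≡⟨ solve 3 (λ x y z → x :* (y :* z) := z :* (x :* y)) refl
                 (a ^ℚ (dim G ∸ dim F)) (b ^ℚ dim F) (b ^ℚ (k ∸ dim G)) ⟩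
          b ^ℚ (k ∸ dim G) * (a ^ℚ (dim G ∸ dim F) * b ^ℚ dim F) ∎

-- Iterated subdivision

pow2 : ℕ → ℚ
pow2 n = ℕ→ℚ (2 ℕ.^ n)

pow2-suc : ∀ n → pow2 (suc n) ≡ pow2 n + pow2 n
pow2-suc n = trans (ℕ→ℚ-+ (2 ℕ.^ n) (2 ℕ.^ n ℕ.+ 0)) (cong (λ z → pow2 n + ℕ→ℚ z) (ℕP.+-identityʳ (2 ℕ.^ n)))

doubling-argument : ∀ n a b →
  pow2 n * (a + (a + b)) + (pow2 n - 1ℚ) * b ≡ pow2 (suc n) * a + (pow2 (suc n) - 1ℚ) * b
doubling-argument n a b = begin
    pow2 n * (a + (a + b)) + (pow2 n - 1ℚ) * b
      ≡⟨ solve 3 (λ N a b → N :* (a :+ (a :+ b)) :+ (N :- con 1ℚ) :* b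
                            := (N :+ N) :* a :+ ((N :+ N) :- con 1ℚ) :* b) refl (pow2 n) a b ⟩
    (pow2 n + pow2 n) * a + ((pow2 n + pow2 n) - 1ℚ) * b
      ≡⟨ cong (λ N → N * a + (N - 1ℚ) * b) (sym (pow2-suc n)) ⟩
    pow2 (suc n) * a + (pow2 (suc n) - 1ℚ) * b ∎

module Iterate (P : FacePoset) (cp : IsCubicalPoset P) {k : ℕ} (bound : DimBound P k) where

  cubical-sdc^ : ∀ n → IsCubicalPoset (sdc^ n P)
  cubical-sdc^ zero    = cp
  cubical-sdc^ (suc n) = Subdivision.isCubicalPoset-sdc (sdc^ n P) (cubical-sdc^ n)

  dimBound-sdc^ : ∀ n → DimBound (sdc^ n P) k
  dimBound-sdc^ zero    = bound
  dimBound-sdc^ (suc n) = Subdivision.dimBound-sdc (sdc^ n P) (cubical-sdc^ n) (dimBound-sdc^ n)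

  faceSum-sdc^ : ∀ n a b → faceSum (sdc^ n P) k a b ≡ faceSum P k (pow2 n * a + (pow2 n - 1ℚ) * b) b
  faceSum-sdc^ zero a b =
    cong (λ z → faceSum P k z b) (solve 2 (λ a b → a := con 1ℚ :* a :+ (con 1ℚ :- con 1ℚ) :* b) refl a b)
  faceSum-sdc^ (suc n) a b = begin
      faceSum (sdc (sdc^ n P)) k a b
        ≡⟨ Subdivision.faceSum-sdc (sdc^ n P) (cubical-sdc^ n) (dimBound-sdc^ n) a b ⟩
      faceSum (sdc^ n P) k (a + (a + b)) b
        ≡⟨ faceSum-sdc^ n (a + (a + b)) b ⟩
      faceSum P k (pow2 n * (a + (a + b)) + (pow2 n - 1ℚ) * b) b
        ≡⟨ cong (λ z → faceSum P k z b) (doubling-argument n a b) ⟩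
      faceSum P k (pow2 (suc n) * a + (pow2 (suc n) - 1ℚ) * b) b ∎

-- The h-polynomial as a face sum

count-as-sum : {P : A → Set} (P? : ∀ x → Dec (P x)) (xs : List A) →
  ℕ→ℚ (length (filter P? xs)) ≡ sumOver xs (λ x → iverson (P? x) 1ℚ)
count-as-sum P? []       = refl
count-as-sum P? (x ∷ xs) with P? x
... | yes _ = trans (ℕ→ℚ-+ 1 (length (filter P? xs))) (cong (1ℚ +_) (count-as-sum P? xs))
... | no _  = trans (count-as-sum P? xs) (sym (ℚP.+-identityˡ _))

module FaceSums (P : FacePoset) {k : ℕ} (bound : DimBound P k) where
  open FacePoset P

  sumByDimension : (g : ℕ → ℚ) →
    sumOver (upTo (suc k)) (λ j → ℕ→ℚ (fVec P j) * g j) ≡ sumOver faces (λ F → g (dim F))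
  sumByDimension g = begin
      sumOver (upTo (suc k)) (λ j → ℕ→ℚ (fVec P j) * g j)
        ≡⟨ sumOver-cong (upTo (suc k)) (λ j _ →
             trans (cong (_* g j) (count-as-sum (λ F → dim F ≟ j) faces))
             (trans (sumOver-*ʳ faces (g j) _) (sumOver-cong faces (λ F _ → iverson-unit (dim F ≟ j) (g j))))) ⟩
      sumOver (upTo (suc k)) (λ j → sumOver faces (λ F → iverson (dim F ≟ j) (g j)))
        ≡⟨ sumOver-swap (upTo (suc k)) faces _ ⟩
      sumOver faces (λ F → sumOver (upTo (suc k)) (λ j → iverson (dim F ≟ j) (g j)))
        ≡⟨ sumOver-cong faces (λ F F∈ → trans
             (sumOver-concentrated (upTo (suc k)) _ (dim F) (upTo⁺ (suc k)) (∈-upTo⁺ (ℕ.s≤s (bound F F∈)))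
                                   (λ j _ j≢dimF → iverson-no (λ dimF≡j → j≢dimF (sym dimF≡j)) (dim F ≟ j) (g j)))
             (iverson-yes refl (dim F ≟ dim F) (g (dim F)))) ⟩
      sumOver faces (λ F → g (dim F)) ∎

  hsc-faceSum : ∀ x → hsc k P x ≡ faceSum P k (ℕ→ℚ 2 * x) (1ℚ - x)
  hsc-faceSum x =
    trans (sumOver-cong (upTo (suc k)) (λ j _ → ℚP.*-assoc (ℕ→ℚ (fVec P j)) ((ℕ→ℚ 2 * x) ^ℚ j) ((1ℚ - x) ^ℚ (k ∸ j))))
          (sumByDimension (λ j → (ℕ→ℚ 2 * x) ^ℚ j * (1ℚ - x) ^ℚ (k ∸ j)))

  faceSum-homogeneous : ∀ c a b → c ^ℚ k * faceSum P k a b ≡ faceSum P k (c * a) (c * b)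
  faceSum-homogeneous c a b = trans (sumOver-*ˡ faces (c ^ℚ k) _) (sumOver-cong faces (λ F F∈ → distribute F (bound F F∈)))
    where
    distribute : ∀ F → dim F ℕ.≤ k →
      c ^ℚ k * (a ^ℚ dim F * b ^ℚ (k ∸ dim F)) ≡ (c * a) ^ℚ dim F * (c * b) ^ℚ (k ∸ dim F)
    distribute F dimF≤k = begin
        c ^ℚ k * (a ^ℚ dim F * b ^ℚ (k ∸ dim F))
          ≡⟨ cong (λ e → c ^ℚ e * (a ^ℚ dim F * b ^ℚ (k ∸ dim F))) (sym (ℕP.m+[n∸m]≡n dimF≤k)) ⟩
        c ^ℚ (dim F ℕ.+ (k ∸ dim F)) * (a ^ℚ dim F * b ^ℚ (k ∸ dim F))
          ≡⟨ cong (_* (a ^ℚ dim F * b ^ℚ (k ∸ dim F))) (^-+ c (dim F) (k ∸ dim F)) ⟩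
        (c ^ℚ dim F * c ^ℚ (k ∸ dim F)) * (a ^ℚ dim F * b ^ℚ (k ∸ dim F))
          ≡⟨ solve 4 (λ p q x y → (p :* q) :* (x :* y) := (p :* x) :* (q :* y)) refl
               (c ^ℚ dim F) (c ^ℚ (k ∸ dim F)) (a ^ℚ dim F) (b ^ℚ (k ∸ dim F)) ⟩
        (c ^ℚ dim F * a ^ℚ dim F) * (c ^ℚ (k ∸ dim F) * b ^ℚ (k ∸ dim F))
          ≡⟨ sym (cong₂ _*_ (*-^ c a (dim F)) (*-^ c b (k ∸ dim F))) ⟩
        (c * a) ^ℚ dim F * (c * b) ^ℚ (k ∸ dim F) ∎

rescale-ratio : ∀ A B .{{_ : NonZero B}} → (B ÷ ℕ→ℚ 2) * (ℕ→ℚ 2 * (A ÷ B)) ≡ A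
rescale-ratio A B = begin
    (B * 1/ ℕ→ℚ 2) * (ℕ→ℚ 2 * (A * 1/ B))
      ≡⟨ solve 5 (λ b i t a j → (b :* i) :* (t :* (a :* j)) := (b :* j) :* ((t :* i) :* a)) refl
           B (1/ ℕ→ℚ 2) (ℕ→ℚ 2) A (1/ B) ⟩
    (B * 1/ B) * ((ℕ→ℚ 2 * 1/ ℕ→ℚ 2) * A)
      ≡⟨ cong₂ (λ p q → p * (q * A)) (ℚP.*-inverseʳ B) (ℚP.*-inverseʳ (ℕ→ℚ 2)) ⟩
    1ℚ * (1ℚ * A)
      ≡⟨ trans (ℚP.*-identityˡ _) (ℚP.*-identityˡ A) ⟩
    A ∎

rescale-complement : ∀ A B .{{_ : NonZero B}} → (B ÷ ℕ→ℚ 2) * (1ℚ - A ÷ B) ≡ (B - A) * 1/ ℕ→ℚ 2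
rescale-complement A B = begin
    (B * 1/ ℕ→ℚ 2) * (1ℚ - A * 1/ B)
      ≡⟨ solve 4 (λ b i a j → (b :* i) :* (con 1ℚ :- a :* j) := b :* i :- (b :* j) :* (a :* i)) refl
           B (1/ ℕ→ℚ 2) A (1/ B) ⟩
    B * 1/ ℕ→ℚ 2 - (B * 1/ B) * (A * 1/ ℕ→ℚ 2)
      ≡⟨ cong (λ p → B * 1/ ℕ→ℚ 2 - p * (A * 1/ ℕ→ℚ 2)) (ℚP.*-inverseʳ B) ⟩
    B * 1/ ℕ→ℚ 2 - 1ℚ * (A * 1/ ℕ→ℚ 2)
      ≡⟨ solve 3 (λ b a i → b :* i :- con 1ℚ :* (a :* i) := (b :- a) :* i) refl B A (1/ ℕ→ℚ 2) ⟩
    (B - A) * 1/ ℕ→ℚ 2 ∎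

iterated-argument : ∀ n x → pow2 n * (ℕ→ℚ 2 * x) + (pow2 n - 1ℚ) * (1ℚ - x) ≡ numerA n x
iterated-argument n x =
  solve 2 (λ N x → N :* (con (ℕ→ℚ 2) :* x) :+ (N :- con 1ℚ) :* (con 1ℚ :- x) := (N :+ con 1ℚ) :* x :+ N :- con 1ℚ)
        refl (pow2 n) x

complement-argument : ∀ n x → (denomB n x - numerA n x) * 1/ ℕ→ℚ 2 ≡ 1ℚ - x
complement-argument n x = begin
    (denomB n x - numerA n x) * 1/ ℕ→ℚ 2
      ≡⟨ solve 3 (λ N x i → ((N :- con 1ℚ) :* x :+ N :+ con 1ℚ :- ((N :+ con 1ℚ) :* x :+ N :- con 1ℚ)) :* i
                            := (con (ℕ→ℚ 2) :* i) :* (con 1ℚ :- x)) refl (pow2 n) x (1/ ℕ→ℚ 2) ⟩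
    (ℕ→ℚ 2 * 1/ ℕ→ℚ 2) * (1ℚ - x)
      ≡⟨ trans (cong (_* (1ℚ - x)) (ℚP.*-inverseʳ (ℕ→ℚ 2))) (ℚP.*-identityˡ (1ℚ - x)) ⟩
    1ℚ - x ∎

proposition3p7 : (K : FacePoset) (k : ℕ) → IsCubicalComplex K → HasDimension K k →
    (n : ℕ) (x : ℚ) .{{_ : NonZero (denomB n x)}} →
      hsc k (sdc^ n K) x ≡
        ((denomB n x ÷ ℕ→ℚ 2) ^ℚ k) * hsc k K (numerA n x ÷ denomB n x)
proposition3p7 K k cc hdim n x = begin
    hsc k (sdc^ n K) x
      ≡⟨ FaceSums.hsc-faceSum (sdc^ n K) (dimBound-sdc^ n) x ⟩
    faceSum (sdc^ n K) k (ℕ→ℚ 2 * x) (1ℚ - x)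
      ≡⟨ faceSum-sdc^ n (ℕ→ℚ 2 * x) (1ℚ - x) ⟩
    faceSum K k (pow2 n * (ℕ→ℚ 2 * x) + (pow2 n - 1ℚ) * (1ℚ - x)) (1ℚ - x)
      ≡⟨ cong₂ (faceSum K k) (trans (iterated-argument n x) (sym (rescale-ratio numer denom)))
                             (sym (trans (rescale-complement numer denom) (complement-argument n x))) ⟩
    faceSum K k (c * (ℕ→ℚ 2 * y)) (c * (1ℚ - y))
      ≡⟨ sym (faceSum-homogeneous c (ℕ→ℚ 2 * y) (1ℚ - y)) ⟩
    c ^ℚ k * faceSum K k (ℕ→ℚ 2 * y) (1ℚ - y)
      ≡⟨ cong (c ^ℚ k *_) (sym (hsc-faceSum y)) ⟩
    c ^ℚ k * hsc k K y ∎
  where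
  open Iterate K (isCubicalPoset-complex K cc) (proj₁ hdim)
  open FaceSums K (proj₁ hdim)
  numer denom c y : ℚ
  numer = numerA n x
  denom = denomB n x
  c = denom ÷ ℕ→ℚ 2
  y = numer ÷ denom
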